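{- Let $G=(V,E)$ be a connected graph with maximum degree $\Delta$ and diameter $\operatorname{diam}(G)$. There is an integer initial load vector $x^{(0)}$ with discrepancy $\Delta\operatorname{diam}(G)$ such that for the RSW-algorithm $x^{(t)}=x^{(t-1)}$ for all $t\in\mathbb{N}$, $t\ge1$.
   Context: Diffusion matrix: $P_{i,j}=1/(2\Delta)$ if $\{i,j\}\in E$, $P_{i,i}=1-\deg(i)/(2\Delta)$, $0$ otherwise. Discrete process: integer loads with $x^{(t)}_i=x^{(t-1)}_i-\sum_{j:\{i,j\}\in E}\Phi^{(t)}_{i,j}$, where $\Phi^{(t)}_{i,j}=-\Phi^{(t)}_{j,i}$ is the integer flow from $i$ to $j$ at step $t$. RSW-algorithm: for each edge $\{i,j\}$ oriented so that $y:=P_{i,j}x^{(t-1)}_i-P_{j,i}x^{(t-1)}_j\ge0$, set $\Phi^{(t)}_{i,j}=\lfloor y\rfloor$ (always round down). Discrepancy of a vector $x$ is $\max_{i,j}(x_i-x_j)$. -}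

module Defs where

open import Data.Bool using (Bool; true; false; if_then_else_)
open import Data.Nat as ℕ using (ℕ; zero; suc; _⊔_)
import Data.Nat.DivMod as ℕD
open import Data.Integer as ℤ using (ℤ; +_; _-_; ∣_∣; -_; _≤ᵇ_)
open import Data.Fin using (Fin)
open import Data.List using (List; []; _∷_; map; foldr; filter; length; concatMap)
open import Data.List.Base using (allFin)
open import Data.Product using (Σ; _×_; _,_; ∃; ∃-syntax)
open import Relation.Binary.PropositionalEquality using (_≡_)
open import Relation.Nullary using (¬_)

record Graph (n : ℕ) : Set where
  field
    adj     : Fin n → Fin n → Bool
    symm    : ∀ i j → adj i j ≡ adj j i
    irrefl  : ∀ i → adj i i ≡ false
open Graph public

deg : ∀ {n} → Graph n → Fin n → ℕ
deg G i = length (filter (λ j → Data.Bool._≟_ (adj G i j) true) (allFin _))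
  where import Data.Bool

maxDegree : ∀ {n} → Graph n → ℕ
maxDegree G = foldr _⊔_ 0 (map (deg G) (allFin _))

data Walk {n : ℕ} (G : Graph n) : Fin n → Fin n → ℕ → Set where
  here : ∀ {i} → Walk G i i 0
  step : ∀ {i j l k} → adj G i j ≡ true → Walk G j l k → Walk G i l (suc k)

Connected : ∀ {n} → Graph n → Set
Connected G = ∀ i j → ∃[ k ] Walk G i j k

-- D is the diameter of G: every pair is at distance ≤ D, and some pair
-- has distance exactly ≥ D (i.e. D = max_{i,j} dist(i,j)).
IsDiameter : ∀ {n} → Graph n → ℕ → Set
IsDiameter G D =
  (∀ i j → ∃[ k ] (k ℕ.≤ D × Walk G i j k)) ×
  (∃[ i ] ∃[ j ] (∀ k → Walk G i j k → D ℕ.≤ k))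

Load : ℕ → Set
Load n = Fin n → ℤ

sumℤ : List ℤ → ℤ
sumℤ = foldr ℤ._+_ (+ 0)

-- discrepancy  max_{i,j} (x_i - x_j)  (the diagonal terms are 0, so the
-- initial value 0 of the fold does not change the maximum)
discrepancy : ∀ {n} → Load n → ℤ
discrepancy x =
  foldr ℤ._⊔_ (+ 0) (concatMap (λ i → map (λ j → x i - x j) (allFin _)) (allFin _))

-- ⌊ m / (2Δ) ⌋ for m ≥ 0 (given as a natural number). If Δ = 0 the graph
-- has no edges, and this value is never used.
floorDiv2Δ : ℕ → ℕ → ℕ
floorDiv2Δ zero    m = 0
floorDiv2Δ (suc d) m = m ℕD./ (2 ℕ.* suc d)

-- RSW flow Φ_{i,j} on an edge {i,j}: with y = P_{ij} x_i - P_{ji} x_j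
-- = (x_i - x_j)/(2Δ); if y ≥ 0 then Φ_{i,j} = ⌊y⌋, otherwise
-- Φ_{i,j} = -Φ_{j,i} = -⌊-y⌋.
rswFlow : ∀ {n} → Graph n → Load n → Fin n → Fin n → ℤ
rswFlow G x i j =
  if x j ≤ᵇ x i
  then + floorDiv2Δ (maxDegree G) ∣ x i - x j ∣
  else - (+ floorDiv2Δ (maxDegree G) ∣ x j - x i ∣)

rswStep : ∀ {n} → Graph n → Load n → Load n
rswStep G x i =
  x i - sumℤ (map (λ j → if adj G i j then rswFlow G x i j else + 0) (allFin _))

rswIter : ∀ {n} → Graph n → Load n → ℕ → Load n
rswIter G x zero    = x
rswIter G x (suc t) = rswStep G (rswIter G x t)

-- The RSW flow over an edge {i,j} is ⌊|x_i - x_j| / (2Δ)⌋, which vanishes as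
-- soon as |x_i - x_j| ≤ Δ.  Call a load *smooth* if neighbours differ by at
-- most Δ; a smooth load is a fixed point of one RSW round, hence of all of
-- them.  Pick vertices f, s with every f–s walk of length ≥ D = diam(G) and
-- let  x_v = Δ · min(D, dist(v, s)).  Truncated distance is 1-Lipschitz
-- along edges, so x is smooth; its values lie in [0, ΔD] and x_f - x_s = ΔD,
-- so its discrepancy is exactly ΔD.

module Submission where

open import Defs
open import Data.Nat using (ℕ; suc; _*_)
open import Data.Integer using (+_)
open import Data.Product using (∃-syntax; _×_)
open import Relation.Binary.PropositionalEquality using (_≡_)

open import Data.Nat as ℕ using (zero; z≤n; s≤s; _≤_; _+_)
import Data.Nat.Properties as ℕP
import Data.Nat.DivMod as ℕD
open import Data.Integer as ℤ using (ℤ; _-_; ∣_∣)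
import Data.Integer.Properties as ℤP
open import Data.Bool using (Bool; true; false; T; _∨_; _∧_; if_then_else_)
open import Data.Bool.Properties using (T-∨; T-∧; T-≡)
open import Data.Bool.ListAction using (any)
open import Data.Fin using (Fin; _≟_)
open import Data.List using (List; []; _∷_; map; foldr; concatMap)
open import Data.List.Base using (allFin)
open import Data.List.Membership.Propositional using (_∈_; find; lose)
open import Data.List.Membership.Propositional.Properties
  using (∈-allFin; ∈-map⁺; ∈-map⁻; ∈-concatMap⁺; ∈-concatMap⁻)
open import Data.List.Relation.Unary.Any using (here; there; satisfied)
open import Data.List.Relation.Unary.Any.Properties using (any⁺; any⁻)
open import Data.Product using (_,_)
open import Data.Sum using (inj₁; inj₂)
open import Data.Unit using (tt)
open import Data.Empty using (⊥-elim)
open import Function.Bundles using (Equivalence)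
open import Relation.Nullary.Decidable using (isYes; toWitness; fromWitness)
open import Relation.Binary.PropositionalEquality
  using (refl; sym; trans; cong; subst; module ≡-Reasoning)

open Equivalence using (to; from)

module Layers {n} (G : Graph n) (s : Fin n) where

  reach : ℕ → Fin n → Bool
  reach zero    v = isYes (v ≟ s)
  reach (suc k) v = reach k v ∨ any (λ u → adj G v u ∧ reach k u) (allFin n)

  reach-mono : ∀ k v → T (reach k v) → T (reach (suc k) v)
  reach-mono k v r = from T-∨ (inj₁ r)

  reach-root : ∀ k → T (reach k s)
  reach-root zero    = fromWitness refl
  reach-root (suc k) = reach-mono k s (reach-root k)

  reach-step : ∀ k v u → adj G v u ≡ true → T (reach k u) → T (reach (suc k) v)
  reach-step k v u a r =
    from T-∨ (inj₂ (any⁺ _ (lose (∈-allFin u) (from T-∧ (from T-≡ a , r)))))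

  reach⇒walk : ∀ k v → T (reach k v) → ∃[ m ] (m ≤ k × Walk G v s m)
  reach⇒walk zero v r with toWitness {a? = v ≟ s} r
  ... | refl = 0 , z≤n , here
  reach⇒walk (suc k) v r with to T-∨ r
  ... | inj₁ r′ with reach⇒walk k v r′
  ...   | m , m≤k , w = m , ℕP.m≤n⇒m≤1+n m≤k , w
  reach⇒walk (suc k) v r | inj₂ r′ with satisfied (any⁻ _ (allFin n) r′)
  ... | u , au with to T-∧ au
  ...   | a , ru with reach⇒walk k u ru
  ...     | m , m≤k , w = suc m , s≤s m≤k , step (to T-≡ a) w

  unreached : ℕ → Fin n → ℕ
  unreached k v = if reach k v then 0 else 1

  -- level k v = #{ j < k : v ∉ layer j } = min(k, dist(v, s)).
  level : ℕ → Fin n → ℕ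
  level zero    v = 0
  level (suc k) v = unreached k v + level k v

  unreached≤1 : ∀ k v → unreached k v ≤ 1
  unreached≤1 k v with reach k v
  ... | true  = z≤n
  ... | false = s≤s z≤n

  unreached-reached : ∀ k v → T (reach k v) → unreached k v ≡ 0
  unreached-reached k v r with reach k v
  ... | true = refl

  level≤ : ∀ k v → level k v ≤ k
  level≤ zero    v = z≤n
  level≤ (suc k) v = ℕP.+-mono-≤ (unreached≤1 k v) (level≤ k v)

  level-root : ∀ k → level k s ≡ 0
  level-root zero    = refl
  level-root (suc k) rewrite unreached-reached k s (reach-root k) = level-root k

  unreached-adj : ∀ k v u → adj G v u ≡ true → unreached (suc k) v ≤ unreached k u
  unreached-adj k v u a with reach k u | reach-step k v u a
  ... | true  | reached = ℕP.≤-reflexive (unreached-reached (suc k) v (reached tt))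
  ... | false | _       = unreached≤1 (suc k) v

  -- Shifted Lipschitz bound, the form that goes through by induction on k.
  level-adj-suc : ∀ k v u → adj G v u ≡ true → level (suc k) v ≤ suc (level k u)
  level-adj-suc zero    v u a = ℕP.+-mono-≤ (unreached≤1 0 v) z≤n
  level-adj-suc (suc k) v u a = begin
    unreached (suc k) v + level (suc k) v ≤⟨ ℕP.+-mono-≤ (unreached-adj k v u a)
                                                        (level-adj-suc k v u a) ⟩
    unreached k u + suc (level k u)       ≡⟨ ℕP.+-suc (unreached k u) (level k u) ⟩
    suc (level (suc k) u)                 ∎
    where open ℕP.≤-Reasoning

  level-adj : ∀ k v u → adj G v u ≡ true → level k v ≤ suc (level k u)
  level-adj k v u a =
    ℕP.≤-trans (ℕP.m≤n+m (level k v) (unreached k v)) (level-adj-suc k v u a)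

  level-far : ∀ D f → (∀ m → Walk G f s m → D ≤ m) → ∀ k → k ≤ D → level k f ≡ k
  level-far D f far zero    _   = refl
  level-far D f far (suc k) k<D with reach k f | reach⇒walk k f
  ... | true  | walk with walk tt
  ...   | m , m≤k , w = ⊥-elim (ℕP.<⇒≱ (ℕP.≤-<-trans m≤k k<D) (far m w))
  level-far D f far (suc k) k<D | false | _ =
    cong suc (level-far D f far k (ℕP.<⇒≤ k<D))

Smooth : ∀ {n} → Graph n → Load n → Set
Smooth G x = ∀ i j → adj G i j ≡ true → ∣ x i - x j ∣ ≤ maxDegree G

floorDiv2Δ-small : ∀ Δ m → m ≤ Δ → floorDiv2Δ Δ m ≡ 0
floorDiv2Δ-small zero    m _   = refl
floorDiv2Δ-small (suc d) m m≤Δ =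
  ℕD.m<n⇒m/n≡0 (ℕP.≤-<-trans m≤Δ (ℕP.m<m+n (suc d) (s≤s z≤n)))

rswFlow-small : ∀ {n} (G : Graph n) (x : Load n) i j →
  ∣ x i - x j ∣ ≤ maxDegree G → rswFlow G x i j ≡ + 0
rswFlow-small G x i j small with x j ℤ.≤ᵇ x i
... | true  rewrite floorDiv2Δ-small (maxDegree G) _ small = refl
... | false rewrite floorDiv2Δ-small (maxDegree G) ∣ x j - x i ∣
                      (subst (_≤ maxDegree G) (ℤP.∣i-j∣≡∣j-i∣ (x i) (x j)) small) = refl

sumℤ-zeros : ∀ {A : Set} (g : A → ℤ) → (∀ a → g a ≡ + 0) → ∀ as → sumℤ (map g as) ≡ + 0
sumℤ-zeros g zero-g []       = refl
sumℤ-zeros g zero-g (a ∷ as) rewrite zero-g a | sumℤ-zeros g zero-g as = refl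

rswStep-smooth : ∀ {n} (G : Graph n) (x : Load n) → Smooth G x → ∀ i → rswStep G x i ≡ x i
rswStep-smooth G x smooth i = begin
  x i - sumℤ (map flow (allFin _)) ≡⟨ cong (x i -_) (sumℤ-zeros flow no-flow (allFin _)) ⟩
  x i - + 0                        ≡⟨ ℤP.+-identityʳ (x i) ⟩
  x i                              ∎
  where
  open ≡-Reasoning
  flow : Fin _ → ℤ
  flow j = if adj G i j then rswFlow G x i j else + 0
  no-flow : ∀ j → flow j ≡ + 0
  no-flow j with adj G i j in a
  ... | true  = rswFlow-small G x i j (smooth i j a)
  ... | false = refl

Smooth-resp : ∀ {n} (G : Graph n) {x y : Load n} → (∀ i → y i ≡ x i) → Smooth G x → Smooth G y
Smooth-resp G {x} {y} y≡x smooth i j a rewrite y≡x i | y≡x j = smooth i j a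

rswIter-smooth : ∀ {n} (G : Graph n) (x : Load n) → Smooth G x → ∀ t i → rswIter G x t i ≡ x i
rswIter-smooth G x smooth zero    i = refl
rswIter-smooth G x smooth (suc t) i =
  trans (rswStep-smooth G (rswIter G x t) (Smooth-resp G previous smooth) i) (previous i)
  where
  previous : ∀ i → rswIter G x t i ≡ x i
  previous = rswIter-smooth G x smooth t

foldr-⊔-lub : ∀ (ys : List ℤ) z c → (∀ y → y ∈ ys → y ℤ.≤ c) → z ℤ.≤ c → foldr ℤ._⊔_ z ys ℤ.≤ c
foldr-⊔-lub []       z c bound z≤c = z≤c
foldr-⊔-lub (y ∷ ys) z c bound z≤c =
  ℤP.⊔-lub (bound y (here refl)) (foldr-⊔-lub ys z c (λ y′ y′∈ → bound y′ (there y′∈)) z≤c)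

foldr-⊔-upper : ∀ (ys : List ℤ) z {y} → y ∈ ys → y ℤ.≤ foldr ℤ._⊔_ z ys
foldr-⊔-upper (y ∷ ys) z (here refl) = ℤP.i≤i⊔j y _
foldr-⊔-upper (y ∷ ys) z (there y∈)  = ℤP.≤-trans (foldr-⊔-upper ys z y∈) (ℤP.i≤j⊔i y _)

differences : ∀ {n} → Load n → List ℤ
differences x = concatMap (λ i → map (λ j → x i - x j) (allFin _)) (allFin _)

differences⁺ : ∀ {n} (x : Load n) i j → x i - x j ∈ differences x
differences⁺ x i j =
  ∈-concatMap⁺ _ (lose (∈-allFin i) (∈-map⁺ (λ j → x i - x j) (∈-allFin j)))

differences⁻ : ∀ {n} (x : Load n) {y} → y ∈ differences x → ∃[ i ] ∃[ j ] (y ≡ x i - x j)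
differences⁻ {n} x y∈ with find (∈-concatMap⁻ _ {xs = allFin n} y∈)
... | i , _ , y∈row with ∈-map⁻ (λ j → x i - x j) y∈row
...   | j , _ , y≡ = i , j , y≡

-- If c bounds all differences and some pair attains it, the discrepancy is c.
-- (The seed 0 of the fold is harmless since x_i - x_i = 0 ≤ c.)
discrepancy-attained : ∀ {n} (x : Load n) c → (∀ i j → x i - x j ℤ.≤ c) →
  ∀ i j → x i - x j ≡ c → discrepancy x ≡ c
discrepancy-attained x c bound i j attained = ℤP.≤-antisym
  (foldr-⊔-lub (differences x) (+ 0) c bound′
    (subst (ℤ._≤ c) (ℤP.+-inverseʳ (x i)) (bound i i)))
  (subst (ℤ._≤ discrepancy x) attained (foldr-⊔-upper (differences x) (+ 0) (differences⁺ x i j)))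
  where
  bound′ : ∀ y → y ∈ differences x → y ℤ.≤ c
  bound′ y y∈ with differences⁻ x y∈
  ... | i′ , j′ , refl = bound i′ j′

∣m-n∣≤ : ∀ m n o → m ≤ o + n → n ≤ o + m → ℕ.∣ m - n ∣ ≤ o
∣m-n∣≤ m n o m≤ n≤ with ℕP.≤-total m n
... | inj₁ m≤n rewrite ℕP.m≤n⇒∣m-n∣≡n∸m m≤n =
  ℕP.m≤n+o⇒m∸n≤o n m (subst (n ≤_) (ℕP.+-comm o m) n≤)
... | inj₂ n≤m rewrite ℕP.∣-∣-comm m n | ℕP.m≤n⇒∣m-n∣≡n∸m n≤m =
  ℕP.m≤n+o⇒m∸n≤o m n (subst (m ≤_) (ℕP.+-comm o n) m≤)

∣+m-+n∣ : ∀ m n → ∣ + m - + n ∣ ≡ ℕ.∣ m - n ∣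
∣+m-+n∣ m n with ℕP.≤-total m n
... | inj₁ m≤n rewrite ℤP.m-n≡m⊖n m n | ℤP.∣⊖∣-≤ m≤n = sym (ℕP.m≤n⇒∣m-n∣≡n∸m m≤n)
... | inj₂ n≤m rewrite ℤP.m-n≡m⊖n m n | ℤP.∣m⊖n∣≡∣n⊖m∣ m n | ℤP.∣⊖∣-≤ n≤m
                     | ℕP.∣-∣-comm m n = sym (ℕP.m≤n⇒∣m-n∣≡n∸m n≤m)

scaled-smooth : ∀ {n} (G : Graph n) (h : Fin n → ℕ) →
  (∀ i j → adj G i j ≡ true → h i ≤ suc (h j)) →
  Smooth G (λ v → + (maxDegree G * h v))
scaled-smooth G h lipschitz i j a = begin
  ∣ + (Δ * h i) - + (Δ * h j) ∣ ≡⟨ ∣+m-+n∣ (Δ * h i) (Δ * h j) ⟩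
  ℕ.∣ Δ * h i - Δ * h j ∣       ≡⟨ ℕP.*-distribˡ-∣-∣ Δ (h i) (h j) ⟨
  Δ * ℕ.∣ h i - h j ∣           ≤⟨ ℕP.*-monoʳ-≤ Δ (∣m-n∣≤ (h i) (h j) 1
                                     (lipschitz i j a)
                                     (lipschitz j i (trans (symm G j i) a))) ⟩
  Δ * 1                         ≡⟨ ℕP.*-identityʳ Δ ⟩
  Δ                             ∎
  where
  open ℕP.≤-Reasoning
  Δ : ℕ
  Δ = maxDegree G

mainTheorem5 : ∀ {n} (G : Graph n) (D : ℕ) → Connected G → IsDiameter G D →
    ∃[ x₀ ] (discrepancy x₀ ≡ + (maxDegree G * D) ×
    (∀ (t : ℕ) i → rswIter G x₀ (suc t) i ≡ rswIter G x₀ t i))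
mainTheorem5 {n} G D _ (_ , f , s , far) = x₀ , disc , stationary
  where
  open Layers G s
  Δ : ℕ
  Δ = maxDegree G

  x₀ : Load n
  x₀ v = + (Δ * level D v)

  smooth : Smooth G x₀
  smooth = scaled-smooth G (level D) (λ i j → level-adj D i j)

  stationary : ∀ t i → rswIter G x₀ (suc t) i ≡ rswIter G x₀ t i
  stationary t i =
    trans (rswIter-smooth G x₀ smooth (suc t) i) (sym (rswIter-smooth G x₀ smooth t i))

  bounded : ∀ i j → x₀ i - x₀ j ℤ.≤ + (Δ * D)
  bounded i j rewrite ℤP.m-n≡m⊖n (Δ * level D i) (Δ * level D j) =
    ℤP.≤-trans (ℤP.m⊖n≤m (Δ * level D i) (Δ * level D j)) (ℤ.+≤+ (ℕP.*-monoʳ-≤ Δ (level≤ D i)))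

  attained : x₀ f - x₀ s ≡ + (Δ * D)
  attained rewrite level-far D f far D ℕP.≤-refl | level-root D | ℕP.*-zeroʳ Δ =
    ℤP.+-identityʳ _

  disc : discrepancy x₀ ≡ + (Δ * D)
  disc = discrepancy-attained x₀ _ bounded f s attained
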